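{- Let $G$ be a finite non-trivial abelian group of odd order. Then there is a subset $S\subseteq G$ with $|S|\le 2\operatorname{rk}(G)+1$ such that $\Gamma_G(S)$ is Hamiltonian.
   Context: For a subset $S$ of a finite abelian group $G$, the addition Cayley graph $\Gamma_G(S)$ has vertex set $G$ and edge set $\{(g',g'')\in G\times G : g'+g''\in S\}$. $\Gamma_G(S)$ is Hamiltonian if there is a listing $(g_1,\ldots,g_n)$ of all $n=|G|$ elements of $G$ with $g_i+g_{i+1}\in S$ for all $i$ (indices mod $n$). $\operatorname{rk}(G)$ is the rank of $G$. -}

module Defs where

open import Data.Nat using (ℕ; zero; suc; _≤_; _<_)
open import Data.Nat.DivMod using (_mod_)
open import Data.Fin using (Fin; toℕ)
open import Data.Fin.Subset using (Subset; _∈_)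
open import Data.Fin.Permutation using (Permutation′; _⟨$⟩ʳ_)
open import Data.List using (List; []; _∷_; length)
open import Data.Product using (Σ; _×_; _,_)
open import Relation.Binary.PropositionalEquality using (_≡_)
open import Algebra.Structures using (IsAbelianGroup)

-- A finite abelian group of order `order`, realised on the carrier Fin order
-- (every finite abelian group is isomorphic to one of these; all notions below
-- are isomorphism invariant).
record FiniteAbelianGroup : Set where
  field
    order : ℕ
    _+_   : Fin order → Fin order → Fin order
    0#    : Fin order
    -_    : Fin order → Fin order
    isAbelianGroup : IsAbelianGroup _≡_ _+_ 0# -_

cyc-suc : ∀ {n} → Fin n → Fin n
cyc-suc {suc m} i = suc (toℕ i) mod suc m

module _ (G : FiniteAbelianGroup) where
  open FiniteAbelianGroup G

  _·_ : ℕ → Fin order → Fin order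
  zero  · g = 0#
  suc k · g = g + (k · g)

  -- g lies in the subgroup generated by the list gs
  -- (in a finite group, ℕ-combinations suffice)
  InSpan : List (Fin order) → Fin order → Set
  InSpan []       g = g ≡ 0#
  InSpan (h ∷ hs) g = Σ ℕ λ k → Σ (Fin order) λ g′ → InSpan hs g′ × (g ≡ (k · h) + g′)

  Generates : List (Fin order) → Set
  Generates gs = ∀ g → InSpan gs g

  IsRank : ℕ → Set
  IsRank r = (Σ (List (Fin order)) λ gs → Generates gs × length gs ≡ r)
           × (∀ gs → Generates gs → r ≤ length gs)

  -- addition Cayley graph Γ_G(S) is Hamiltonian: a listing (g_0,…,g_{n-1}) of
  -- all elements of G (a permutation of Fin order) with g_i + g_{i+1} ∈ S,
  -- indices mod n
  Hamiltonian : Subset order → Set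
  Hamiltonian S = Σ (Permutation′ order) λ π →
    ∀ i → ((π ⟨$⟩ʳ i) + (π ⟨$⟩ʳ cyc-suc i)) ∈ S

{-# OPTIONS --safe #-}
-- Induction along a generating list, adjoining one generator e at a time to the subgroup H
-- generated so far, which carries a closed walk x, …, y through all of H whose consecutive sums
-- lie in S. Let m be the least positive integer with m·e ∈ H. Then |⟨e, H⟩| = m·|H|, so |G| is
-- the product of these indices, and as |G| is odd, m = 2M + 1 and |H| are odd. Walk once around
-- H; then, for k = 1, …, M, walk twice around H while alternately adding k·e and −k·e. The
-- shifts cancel in every sum inside a pass, and as |H| is odd the second pass carries the
-- opposite signs, so this visits both cosets ±k·e + H. Every junction has sum e + y + x and the
-- closing edge has sum −M·e + y + x, so two new sums per generator suffice.
module Submission where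

open import Defs hiding (_·_)
open import Data.Nat using (ℕ; _≤_; _<_; _+_; _*_)
open import Data.Nat.Divisibility using (_∣_)
open import Data.Fin.Subset using (Subset; ∣_∣)
open import Data.Product using (Σ; _×_)
open import Relation.Nullary using (¬_)

open import Algebra.Bundles using (AbelianGroup)
import Algebra.Properties.CommutativeSemigroup as CommutativeSemigroupProperties
import Algebra.Properties.Group as GroupProperties
open import Data.Empty using (⊥-elim)
open import Data.Fin using (Fin; zero; suc; toℕ; fromℕ; fromℕ<; cast; combine; remQuot; punchOut)
import Data.Fin.Properties as Finₚ
open import Data.Fin.Permutation using (Permutation′; permutation; _⟨$⟩ʳ_)
import Data.Fin.Subset as Subset
import Data.Fin.Subset.Properties as Subsetₚ
open import Data.List using (List; []; _∷_; _++_; length; lookup; map)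
open import Data.List.Properties using (length-++)
open import Data.List.Membership.Propositional using (_∈_)
open import Data.List.Membership.Propositional.Properties using (∈-++⁺ˡ; ∈-++⁺ʳ)
open import Data.List.Relation.Unary.Any using (here; there; index)
open import Data.List.Relation.Unary.Any.Properties using (lookup-index)
open import Data.Nat using (zero; suc; z≤n; s≤s; _≤?_; _≤′_; ≤′-refl; ≤′-step; NonZero)
open import Data.Nat.DivMod using (_/_; _%_; m≡m%n+[m/n]*n; m%n<n; m<n⇒m%n≡m; n%n≡0)
open import Data.Nat.Divisibility using (divides; ∣-refl; ∣-trans; ∣m∣n⇒∣m+n; n∣m*n; m∣m*n)
import Data.Nat.Properties as ℕₚ
open import Data.Nat.Tactic.RingSolver using (solve-∀)
open import Data.Product using (∃-syntax; _,_; proj₁; proj₂; uncurry)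
import Data.Product as Product
open import Data.Sum using (_⊎_; inj₁; inj₂; [_,_]′)
import Data.Sum as Sum
open import Data.Vec using ([]; _∷_)
open import Function using (_∘_)
open import Function.Definitions using (Injective)
open import Relation.Binary.PropositionalEquality
open import Relation.Nullary using (yes; no)
open import Relation.Unary using (Decidable)

open ≡-Reasoning

¬2∣⇒≡1+[n+n] : ∀ {n} → ¬ 2 ∣ n → ∃[ k ] n ≡ suc (k + k)
¬2∣⇒≡1+[n+n] {zero} 2∤n = ⊥-elim (2∤n (divides 0 refl))
¬2∣⇒≡1+[n+n] {suc zero} _ = 0 , refl
¬2∣⇒≡1+[n+n] {suc (suc n)} 2∤n with k , refl ← ¬2∣⇒≡1+[n+n] (2∤n ∘ ∣m∣n⇒∣m+n ∣-refl) =
  suc k , cong (2 +_) (sym (ℕₚ.+-suc k k))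

¬∣m*n⇒¬∣m : ∀ {d} m n → ¬ d ∣ m * n → ¬ d ∣ m
¬∣m*n⇒¬∣m m n d∤m*n d∣m = d∤m*n (∣-trans d∣m (m∣m*n n))

¬∣m*n⇒¬∣n : ∀ {d} m n → ¬ d ∣ m * n → ¬ d ∣ n
¬∣m*n⇒¬∣n m n d∤m*n d∣n = d∤m*n (∣-trans d∣n (n∣m*n m))

least-witness : ∀ {P : ℕ → Set} → Decidable P → ∀ {n} → P n →
                ∃[ m ] P m × (∀ {k} → k < m → ¬ P k)
least-witness P? {zero} p = 0 , p , λ ()
least-witness P? {suc n} p with P? 0
... | yes p₀ = 0 , p₀ , λ ()
... | no ¬p₀ with m , pm , below ← least-witness (λ k → P? (suc k)) {n} p =
  suc m , pm , λ { {zero} _ → ¬p₀ ; {suc k} k<m → below (ℕₚ.≤-pred k<m) }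

-- Finite sets

∣p∪q∣≤∣p∣+∣q∣ : ∀ {n} (p q : Subset n) → ∣ p Subset.∪ q ∣ ≤ ∣ p ∣ + ∣ q ∣
∣p∪q∣≤∣p∣+∣q∣ [] [] = z≤n
∣p∪q∣≤∣p∣+∣q∣ (Subset.inside ∷ p) (Subset.inside ∷ q) =
  s≤s (ℕₚ.≤-trans (∣p∪q∣≤∣p∣+∣q∣ p q) (ℕₚ.+-monoʳ-≤ ∣ p ∣ (ℕₚ.n≤1+n ∣ q ∣)))
∣p∪q∣≤∣p∣+∣q∣ (Subset.inside ∷ p) (Subset.outside ∷ q) = s≤s (∣p∪q∣≤∣p∣+∣q∣ p q)
∣p∪q∣≤∣p∣+∣q∣ (Subset.outside ∷ p) (Subset.inside ∷ q) =
  ℕₚ.≤-trans (s≤s (∣p∪q∣≤∣p∣+∣q∣ p q)) (ℕₚ.≤-reflexive (sym (ℕₚ.+-suc ∣ p ∣ ∣ q ∣)))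
∣p∪q∣≤∣p∣+∣q∣ (Subset.outside ∷ p) (Subset.outside ∷ q) = ∣p∪q∣≤∣p∣+∣q∣ p q

fromList : ∀ {n} → List (Fin n) → Subset n
fromList xs = Subset.⋃ (map Subset.⁅_⁆ xs)

∣fromList∣≤length : ∀ {n} (xs : List (Fin n)) → ∣ fromList xs ∣ ≤ length xs
∣fromList∣≤length {n} [] = ℕₚ.≤-reflexive (Subsetₚ.∣⊥∣≡0 n)
∣fromList∣≤length (x ∷ xs) = ℕₚ.≤-trans (∣p∪q∣≤∣p∣+∣q∣ Subset.⁅ x ⁆ (fromList xs))
  (ℕₚ.≤-trans (ℕₚ.≤-reflexive (cong (_+ _) (Subsetₚ.∣⁅x⁆∣≡1 x))) (s≤s (∣fromList∣≤length xs)))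

∈⇒∈fromList : ∀ {n} {x : Fin n} {xs} → x ∈ xs → x Subset.∈ fromList xs
∈⇒∈fromList {xs = y ∷ ys} (here refl) = Subsetₚ.p⊆p∪q (fromList ys) (Subsetₚ.x∈⁅x⁆ y)
∈⇒∈fromList {xs = y ∷ ys} (there x∈ys) = Subsetₚ.q⊆p∪q Subset.⁅ y ⁆ (fromList ys) (∈⇒∈fromList x∈ys)

injective⇒surjective : ∀ {n} {f : Fin n → Fin n} → Injective _≡_ _≡_ f → ∀ a → ∃[ i ] f i ≡ a
injective⇒surjective {suc n} {f} f-injective a with Finₚ.any? (λ i → f i Finₚ.≟ a)
... | yes hit = hit
... | no miss = ⊥-elim (ℕₚ.1+n≰n (Finₚ.injective⇒≤ g-injective))
  where
  g : Fin (suc n) → Fin n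
  g i = punchOut {i = a} {j = f i} (λ a≡fi → miss (i , sym a≡fi))
  g-injective : Injective _≡_ _≡_ g
  g-injective eq = f-injective (Finₚ.punchOut-injective {i = a} _ _ eq)

cast-cyc-suc : ∀ {m n} (eq : m ≡ n) (i : Fin m) → cast eq (cyc-suc i) ≡ cyc-suc (cast eq i)
cast-cyc-suc refl i = trans (Finₚ.cast-is-id refl _) (cong cyc-suc (sym (Finₚ.cast-is-id refl i)))

-- Walks

data Walk {A : Set} (R : A → A → Set) : A → List A → A → Set where
  []  : ∀ {x} → Walk R x [] x
  _∷_ : ∀ {x y ys z} → R x y → Walk R y ys z → Walk R x (y ∷ ys) z

module _ {A : Set} {R : A → A → Set} where

  walk-++ : ∀ {a xs b c ys d} → Walk R a xs b → R b c → Walk R c ys d → Walk R a (xs ++ c ∷ ys) d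
  walk-++ []      r w′ = r ∷ w′
  walk-++ (s ∷ w) r w′ = s ∷ walk-++ w r w′

  walk-map : ∀ {R′ : A → A → Set} → (∀ {u v} → R u v → R′ u v) →
             ∀ {a xs b} → Walk R a xs b → Walk R′ a xs b
  walk-map f []      = []
  walk-map f (r ∷ w) = f r ∷ walk-map f w

  walk-lookup : ∀ {x xs y} → Walk R x xs y → ∀ (i j : Fin (length (x ∷ xs))) →
                toℕ j ≡ suc (toℕ i) → R (lookup (x ∷ xs) i) (lookup (x ∷ xs) j)
  walk-lookup (r ∷ w) zero    (suc zero) refl = r
  walk-lookup (r ∷ w) (suc i) (suc j)    eq   = walk-lookup w i j (ℕₚ.suc-injective eq)

  walk-last : ∀ {x xs y} → Walk R x xs y → lookup (x ∷ xs) (fromℕ (length xs)) ≡ y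
  walk-last []      = refl
  walk-last (r ∷ w) = walk-last w

  closedWalk-lookup : ∀ {x xs y} → Walk R x xs y → R y x → ∀ i →
                      R (lookup (x ∷ xs) i) (lookup (x ∷ xs) (cyc-suc i))
  closedWalk-lookup {x} {xs} w close i with ℕₚ.m≤n⇒m<n∨m≡n (Finₚ.toℕ<n i)
  ... | inj₁ 1+i<n = walk-lookup w i (cyc-suc i) (trans (Finₚ.toℕ-fromℕ< _) (m<n⇒m%n≡m 1+i<n))
  ... | inj₂ 1+i≡n = subst₂ R (trans (sym (walk-last w)) (cong (lookup (x ∷ xs)) (sym i≡last)))
                               (cong (lookup (x ∷ xs)) (sym next≡0)) close
    where
    i≡last : i ≡ fromℕ (length xs)
    i≡last = Finₚ.toℕ-injective (trans (ℕₚ.suc-injective 1+i≡n) (sym (Finₚ.toℕ-fromℕ _)))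
    next≡0 : cyc-suc i ≡ zero
    next≡0 = Finₚ.toℕ-injective (trans (Finₚ.toℕ-fromℕ< _) (trans (cong (_% suc (length xs)) 1+i≡n) (n%n≡0 (suc (length xs)))))

closedWalk⇒permutation : ∀ {n} {R : Fin n → Fin n → Set} {x xs y} →
  Walk R x xs y → R y x → length (x ∷ xs) ≡ n → (∀ a → a ∈ x ∷ xs) →
  Σ (Permutation′ n) λ π → ∀ i → R (π ⟨$⟩ʳ i) (π ⟨$⟩ʳ cyc-suc i)
closedWalk⇒permutation {n} {R} {x} {xs} w close len visits = permutation to from to∘from from∘to , edge
  where
  to : Fin n → Fin n
  to i = lookup (x ∷ xs) (cast (sym len) i)
  from : Fin n → Fin n
  from a = cast len (index (visits a))
  to∘from : ∀ a → to (from a) ≡ a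
  to∘from a = trans (cong (lookup (x ∷ xs)) (Finₚ.cast-involutive (sym len) len _))
                    (sym (lookup-index (visits a)))
  from-injective : Injective _≡_ _≡_ from
  from-injective {a} {b} eq = trans (sym (to∘from a)) (trans (cong to eq) (to∘from b))
  from∘to : ∀ i → from (to i) ≡ i
  from∘to i with a , refl ← injective⇒surjective from-injective i = cong from (to∘from a)
  edge : ∀ i → R (to i) (to (cyc-suc i))
  edge i = subst (R (to i)) (cong (lookup (x ∷ xs)) (sym (cast-cyc-suc (sym len) i)))
                 (closedWalk-lookup w close (cast (sym len) i))

-- Subgroups generated by lists

module _ (G : FiniteAbelianGroup) where
  open FiniteAbelianGroup G renaming (_+_ to infixl 6 _⊕_; -_ to infix 8 ⊖_)

  private
    Elt : Set
    Elt = Fin order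

    abelianGroup : AbelianGroup _ _
    abelianGroup = record { isAbelianGroup = isAbelianGroup }

  open AbelianGroup abelianGroup using (assoc; comm; identityˡ; identityʳ; inverseˡ; inverseʳ; group; commutativeSemigroup)
  open GroupProperties group using (∙-cancelˡ; inverseʳ-unique; x≈z//y; \\-leftDividesʳ)
  open CommutativeSemigroupProperties commutativeSemigroup using (interchange; x∙yz≈y∙xz; xy∙z≈y∙xz)

  infixr 7 _·_
  _·_ : ℕ → Elt → Elt
  _·_ = Defs._·_ G

  infix 4 _∈⟨_⟩
  _∈⟨_⟩ : Elt → List Elt → Set
  g ∈⟨ hs ⟩ = InSpan G hs g

  ·-homo-+ : ∀ k l g → (k + l) · g ≡ k · g ⊕ l · g
  ·-homo-+ zero    l g = sym (identityˡ (l · g))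
  ·-homo-+ (suc k) l g = trans (cong (g ⊕_) (·-homo-+ k l g)) (sym (assoc g (k · g) (l · g)))

  ·-assoc : ∀ k l g → (k * l) · g ≡ k · (l · g)
  ·-assoc zero    l g = refl
  ·-assoc (suc k) l g = trans (·-homo-+ l (k * l) g) (cong (l · g ⊕_) (·-assoc k l g))

  shifted-sum : ∀ {a b} → a ⊕ b ≡ 0# → ∀ u v → (a ⊕ u) ⊕ (b ⊕ v) ≡ u ⊕ v
  shifted-sum {a} {b} a⊕b≡0 u v = begin
    (a ⊕ u) ⊕ (b ⊕ v) ≡⟨ interchange a u b v ⟩
    (a ⊕ b) ⊕ (u ⊕ v) ≡⟨ cong (_⊕ (u ⊕ v)) a⊕b≡0 ⟩
    0# ⊕ (u ⊕ v)      ≡⟨ identityˡ (u ⊕ v) ⟩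
    u ⊕ v             ∎

  ⊖l·g⊕[[k+l]·g⊕h]≡k·g⊕h : ∀ k l g h → ⊖ (l · g) ⊕ ((k + l) · g ⊕ h) ≡ k · g ⊕ h
  ⊖l·g⊕[[k+l]·g⊕h]≡k·g⊕h k l g h = begin
    ⊖ (l · g) ⊕ ((k + l) · g ⊕ h)       ≡⟨ cong (λ t → ⊖ (l · g) ⊕ (t ⊕ h)) (trans (·-homo-+ k l g) (comm _ _)) ⟩
    ⊖ (l · g) ⊕ (l · g ⊕ k · g ⊕ h)     ≡⟨ cong (⊖ (l · g) ⊕_) (assoc (l · g) (k · g) h) ⟩
    ⊖ (l · g) ⊕ (l · g ⊕ (k · g ⊕ h))   ≡⟨ \\-leftDividesʳ (l · g) (k · g ⊕ h) ⟩
    k · g ⊕ h                           ∎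

  finite-order : ∀ g → ∃[ p ] suc p · g ≡ 0#
  finite-order g =
    let i , j , i<j , i·g≡j·g = Finₚ.pigeonhole (ℕₚ.n<1+n order) (λ i → toℕ i · g)
        p , i+1+p≡j = ℕₚ.m≤n⇒∃[o]m+o≡n i<j
    in p , ∙-cancelˡ (toℕ i · g) _ _ (begin
      toℕ i · g ⊕ suc p · g ≡⟨ ·-homo-+ (toℕ i) (suc p) g ⟨
      (toℕ i + suc p) · g   ≡⟨ cong (_· g) (trans (ℕₚ.+-suc (toℕ i) p) i+1+p≡j) ⟩
      toℕ j · g             ≡⟨ i·g≡j·g ⟨
      toℕ i · g             ≡⟨ identityʳ (toℕ i · g) ⟨
      toℕ i · g ⊕ 0#        ∎)

  0∈⟨⟩ : ∀ hs → 0# ∈⟨ hs ⟩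
  0∈⟨⟩ []       = refl
  0∈⟨⟩ (h ∷ hs) = 0 , 0# , 0∈⟨⟩ hs , sym (identityˡ 0#)

  ⊕-∈⟨⟩ : ∀ hs {g g′} → g ∈⟨ hs ⟩ → g′ ∈⟨ hs ⟩ → g ⊕ g′ ∈⟨ hs ⟩
  ⊕-∈⟨⟩ []       refl refl = identityˡ 0#
  ⊕-∈⟨⟩ (h ∷ hs) (k , g , g∈ , refl) (k′ , g′ , g′∈ , refl) =
    k + k′ , g ⊕ g′ , ⊕-∈⟨⟩ hs g∈ g′∈ ,
    trans (interchange (k · h) g (k′ · h) g′) (cong (_⊕ (g ⊕ g′)) (sym (·-homo-+ k k′ h)))

  ·-∈⟨⟩ : ∀ hs k {g} → g ∈⟨ hs ⟩ → k · g ∈⟨ hs ⟩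
  ·-∈⟨⟩ hs zero    g∈ = 0∈⟨⟩ hs
  ·-∈⟨⟩ hs (suc k) g∈ = ⊕-∈⟨⟩ hs g∈ (·-∈⟨⟩ hs k g∈)

  ⊖-∈⟨⟩ : ∀ hs {g} → g ∈⟨ hs ⟩ → ⊖ g ∈⟨ hs ⟩
  ⊖-∈⟨⟩ hs {g} g∈ with p , g⊕p·g≡0 ← finite-order g =
    subst (_∈⟨ hs ⟩) (inverseʳ-unique g (p · g) g⊕p·g≡0) (·-∈⟨⟩ hs p g∈)

  coset-decomposition : ∀ {e hs m} .{{_ : NonZero m}} → m · e ∈⟨ hs ⟩ → ∀ {g} → g ∈⟨ e ∷ hs ⟩ →
                        ∃[ k ] k < m × ∃[ h ] h ∈⟨ hs ⟩ × g ≡ k · e ⊕ h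
  coset-decomposition {e} {hs} {m} m·e∈ (k , h , h∈ , refl) =
    k % m , m%n<n k m , (k / m) · (m · e) ⊕ h , ⊕-∈⟨⟩ hs (·-∈⟨⟩ hs (k / m) m·e∈) h∈ , (begin
      k · e ⊕ h                               ≡⟨ cong (λ t → t · e ⊕ h) (m≡m%n+[m/n]*n k m) ⟩
      (k % m + k / m * m) · e ⊕ h             ≡⟨ cong (_⊕ h) (·-homo-+ (k % m) (k / m * m) e) ⟩
      (k % m) · e ⊕ (k / m * m) · e ⊕ h       ≡⟨ cong (λ t → (k % m) · e ⊕ t ⊕ h) (·-assoc (k / m) m e) ⟩
      (k % m) · e ⊕ (k / m) · (m · e) ⊕ h     ≡⟨ assoc _ _ h ⟩
      (k % m) · e ⊕ ((k / m) · (m · e) ⊕ h)   ∎)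

  record Enumeration (hs : List Elt) : Set where
    field
      size           : ℕ
      elem           : Fin size → Elt
      elem-injective : Injective _≡_ _≡_ elem
      elem∈⟨⟩        : ∀ i → elem i ∈⟨ hs ⟩
      ⟨⟩⊆elem        : ∀ {g} → g ∈⟨ hs ⟩ → ∃[ i ] elem i ≡ g

    infix 4 _∈⟨⟩?
    _∈⟨⟩? : Decidable (_∈⟨ hs ⟩)
    g ∈⟨⟩? with Finₚ.any? (λ i → elem i Finₚ.≟ g)
    ... | yes (i , refl) = yes (elem∈⟨⟩ i)
    ... | no  ¬hit       = no (¬hit ∘ ⟨⟩⊆elem)

  module Adjoin (e : Elt) {hs : List Elt} (E : Enumeration hs) where
    open Enumeration E

    -- opaque, since unfolding this search makes type checking intractable
    private opaque
      least : ∃[ m ] suc m · e ∈⟨ hs ⟩ × (∀ {k} → k < m → ¬ suc k · e ∈⟨ hs ⟩)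
      least with p , p·e≡0 ← finite-order e =
        least-witness (λ k → suc k · e ∈⟨⟩?) {p} (subst (_∈⟨ hs ⟩) (sym p·e≡0) (0∈⟨⟩ hs))

    ord : ℕ
    ord = suc (proj₁ least)

    ord·e∈⟨⟩ : ord · e ∈⟨ hs ⟩
    ord·e∈⟨⟩ = proj₁ (proj₂ least)

    ord-minimal : ∀ {k} → suc k < ord → ¬ suc k · e ∈⟨ hs ⟩
    ord-minimal = proj₂ (proj₂ least) ∘ ℕₚ.≤-pred

    coset-injective-≤ : ∀ {k k′ h h′} → k ≤ k′ → k′ < ord → h ∈⟨ hs ⟩ → h′ ∈⟨ hs ⟩ →
                        k · e ⊕ h ≡ k′ · e ⊕ h′ → k ≡ k′
    coset-injective-≤ {k} {k′} {h} {h′} k≤k′ k′<ord h∈ h′∈ eq with ℕₚ.m≤n⇒∃[o]m+o≡n k≤k′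
    ... | zero  , k+0≡k′ = trans (sym (ℕₚ.+-identityʳ k)) k+0≡k′
    ... | suc d , k+d≡k′ = ⊥-elim (ord-minimal d<ord (subst (_∈⟨ hs ⟩) h-h′≡d·e (⊕-∈⟨⟩ hs h∈ (⊖-∈⟨⟩ hs h′∈))))
      where
      d<ord : suc d < ord
      d<ord = ℕₚ.≤-<-trans (ℕₚ.m≤n+m (suc d) k) (subst (_< ord) (sym k+d≡k′) k′<ord)
      h≡d·e+h′ : h ≡ suc d · e ⊕ h′
      h≡d·e+h′ = ∙-cancelˡ (k · e) _ _ (begin
        k · e ⊕ h                ≡⟨ eq ⟩
        k′ · e ⊕ h′              ≡⟨ cong (λ t → t · e ⊕ h′) k+d≡k′ ⟨
        (k + suc d) · e ⊕ h′     ≡⟨ cong (_⊕ h′) (·-homo-+ k (suc d) e) ⟩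
        k · e ⊕ suc d · e ⊕ h′   ≡⟨ assoc _ _ h′ ⟩
        k · e ⊕ (suc d · e ⊕ h′) ∎)
      h-h′≡d·e : h ⊕ ⊖ h′ ≡ suc d · e
      h-h′≡d·e = sym (x≈z//y (suc d · e) h′ h (sym h≡d·e+h′))

    coset-injective : ∀ {k k′ h h′} → k < ord → k′ < ord → h ∈⟨ hs ⟩ → h′ ∈⟨ hs ⟩ →
                      k · e ⊕ h ≡ k′ · e ⊕ h′ → k ≡ k′
    coset-injective {k} {k′} k<ord k′<ord h∈ h′∈ eq with ℕₚ.≤-total k k′
    ... | inj₁ k≤k′ = coset-injective-≤ k≤k′ k′<ord h∈ h′∈ eq
    ... | inj₂ k′≤k = sym (coset-injective-≤ k′≤k k<ord h′∈ h∈ (sym eq))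

    private
      point : Fin ord × Fin size → Elt
      point (q , r) = toℕ q · e ⊕ elem r

      point-injective : Injective _≡_ _≡_ point
      point-injective {q , r} {q′ , r′} eq =
        cong₂ _,_ q≡q′ (elem-injective (∙-cancelˡ (toℕ q · e) _ _ (trans eq (cong (λ t → toℕ t · e ⊕ elem r′) (sym q≡q′)))))
        where
        q≡q′ : q ≡ q′
        q≡q′ = Finₚ.toℕ-injective (coset-injective (Finₚ.toℕ<n q) (Finₚ.toℕ<n q′) (elem∈⟨⟩ r) (elem∈⟨⟩ r′) eq)

      remQuot-injective : Injective _≡_ _≡_ (remQuot {ord} size)
      remQuot-injective {i} {j} eq =
        trans (sym (Finₚ.combine-remQuot size i)) (trans (cong (uncurry combine) eq) (Finₚ.combine-remQuot size j))

    enumeration : Enumeration (e ∷ hs)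
    enumeration = record
      { size           = ord * size
      ; elem           = point ∘ remQuot size
      ; elem-injective = remQuot-injective ∘ point-injective
      ; elem∈⟨⟩        = λ i → let q , r = remQuot {ord} size i in toℕ q , elem r , elem∈⟨⟩ r , refl
      ; ⟨⟩⊆elem        = onto
      }
      where
      onto : ∀ {g} → g ∈⟨ e ∷ hs ⟩ → ∃[ i ] point (remQuot {ord} size i) ≡ g
      onto g∈ with coset-decomposition {m = ord} ord·e∈⟨⟩ g∈
      ... | k , k<ord , h , h∈ , refl with ⟨⟩⊆elem h∈
      ... | r , refl =
        combine {ord} (fromℕ< k<ord) r ,
        trans (cong point (Finₚ.remQuot-combine {ord} {size} (fromℕ< k<ord) r))
              (cong (λ t → t · e ⊕ elem r) (Finₚ.toℕ-fromℕ< k<ord))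

  enumerate : ∀ hs → Enumeration hs
  enumerate []       = record
    { size           = 1
    ; elem           = λ _ → 0#
    ; elem-injective = λ { {zero} {zero} _ → refl }
    ; elem∈⟨⟩        = λ _ → refl
    ; ⟨⟩⊆elem        = λ { refl → zero , refl }
    }
  enumerate (e ∷ hs) = Adjoin.enumeration e (enumerate hs)

  -- Closed walks in the addition Cayley graph

  SumIn : List Elt → Elt → Elt → Set
  SumIn S u v = u ⊕ v ∈ S

  SumIn-shift : ∀ {S a b u v} → a ⊕ b ≡ 0# → SumIn S u v → SumIn S (a ⊕ u) (b ⊕ v)
  SumIn-shift {S} a⊕b≡0 = subst (_∈ S) (sym (shifted-sum a⊕b≡0 _ _))

  record CayleyCycle (hs : List Elt) (n : ℕ) : Set where
    field
      sums        : List Elt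
      sums-length : length sums ≤ 2 * length hs + 1
      first       : Elt
      rest        : List Elt
      last        : Elt
      walk        : Walk (SumIn sums) first rest last
      closing     : SumIn sums last first
      length≡     : length (first ∷ rest) ≡ n
      visits      : ∀ {g} → g ∈⟨ hs ⟩ → g ∈ first ∷ rest

  alternate : Elt → Elt → List Elt → List Elt
  alternate a b []       = []
  alternate a b (z ∷ zs) = a ⊕ z ∷ alternate b a zs

  length-alternate : ∀ a b zs → length (alternate a b zs) ≡ length zs
  length-alternate a b []       = refl
  length-alternate a b (z ∷ zs) = cong suc (length-alternate b a zs)

  ∈-alternate : ∀ {a b z zs} → z ∈ zs → a ⊕ z ∈ alternate a b zs ⊎ a ⊕ z ∈ alternate b a zs
  ∈-alternate (here refl)  = inj₁ (here refl)
  ∈-alternate (there z∈zs) = Sum.swap (Sum.map there there (∈-alternate z∈zs))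

  walk-alternate : ∀ {S a b x xs y} → a ⊕ b ≡ 0# → Walk (SumIn S) x xs y → ¬ 2 ∣ length (x ∷ xs) →
                   Walk (SumIn S) (a ⊕ x) (alternate b a xs) (a ⊕ y)
  walk-alternate a⊕b≡0 []           _      = []
  walk-alternate a⊕b≡0 (r ∷ [])     2∤len = ⊥-elim (2∤len ∣-refl)
  walk-alternate {a = a} {b} a⊕b≡0 (r ∷ r′ ∷ w) 2∤len =
    SumIn-shift a⊕b≡0 r ∷ SumIn-shift (trans (comm b a) a⊕b≡0) r′ ∷
    walk-alternate a⊕b≡0 w (2∤len ∘ ∣m∣n⇒∣m+n ∣-refl)

  module Extend (e : Elt) {hs : List Elt} (M : ℕ) (m·e∈⟨⟩ : suc (M + M) · e ∈⟨ hs ⟩)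
                {n : ℕ} (C : CayleyCycle hs n) (2∤n : ¬ 2 ∣ n) where
    open CayleyCycle C

    private
      L : List Elt
      L = first ∷ rest

      block : Elt → List Elt
      block a = alternate a (⊖ a) L ++ alternate (⊖ a) a L

      walk-block : ∀ a → Walk (SumIn sums) (a ⊕ first) (alternate (⊖ a) a rest ++ alternate (⊖ a) a L) (⊖ a ⊕ last)
      walk-block a = walk-++ (walk-alternate (inverseʳ a) walk 2∤L) (SumIn-shift (inverseʳ a) closing)
                             (walk-alternate (inverseˡ a) walk 2∤L)
        where
        2∤L : ¬ 2 ∣ length L
        2∤L = 2∤n ∘ subst (2 ∣_) length≡

      ∈-block : ∀ {a z} → z ∈ L → a ⊕ z ∈ block a × ⊖ a ⊕ z ∈ block a
      ∈-block {a} z∈L = [ ∈-++⁺ˡ , ∈-++⁺ʳ (alternate a (⊖ a) L) ]′ (∈-alternate z∈L)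
                      , [ ∈-++⁺ʳ (alternate a (⊖ a) L) , ∈-++⁺ˡ ]′ (∈-alternate z∈L)

      length-block : ∀ a → length (block a) ≡ length L + length L
      length-block a = trans (length-++ (alternate a (⊖ a) L))
                             (cong₂ _+_ (length-alternate a (⊖ a) L) (length-alternate (⊖ a) a L))

      tour : ℕ → List Elt
      tour zero    = rest
      tour (suc j) = tour j ++ block (suc j · e)

      tour-end : ℕ → Elt
      tour-end zero    = last
      tour-end (suc j) = ⊖ (suc j · e) ⊕ last

      junction : ∀ j → tour-end j ⊕ (suc j · e ⊕ first) ≡ e ⊕ (last ⊕ first)
      junction zero    = begin
        last ⊕ (e ⊕ 0# ⊕ first)          ≡⟨ cong (λ t → last ⊕ (t ⊕ first)) (identityʳ e) ⟩
        last ⊕ (e ⊕ first)               ≡⟨ x∙yz≈y∙xz last e first ⟩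
        e ⊕ (last ⊕ first)               ∎
      junction (suc j) = begin
        ⊖ A ⊕ last ⊕ (e ⊕ A ⊕ first)     ≡⟨ cong (⊖ A ⊕ last ⊕_) (xy∙z≈y∙xz e A first) ⟩
        ⊖ A ⊕ last ⊕ (A ⊕ (e ⊕ first))   ≡⟨ shifted-sum (inverseˡ A) last (e ⊕ first) ⟩
        last ⊕ (e ⊕ first)               ≡⟨ x∙yz≈y∙xz last e first ⟩
        e ⊕ (last ⊕ first)               ∎
        where
        A : Elt
        A = suc j · e

      -- stated for every j, in place of M, to allow case analysis on it
      SumIn-closing : ∀ j → SumIn (e ⊕ (last ⊕ first) ∷ ⊖ (j · e) ⊕ (last ⊕ first) ∷ sums) (tour-end j) first
      SumIn-closing zero    = there (there closing)
      SumIn-closing (suc j) = there (here (assoc _ last first))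

      sums′ : List Elt
      sums′ = e ⊕ (last ⊕ first) ∷ ⊖ (M · e) ⊕ (last ⊕ first) ∷ sums

      walk-tour : ∀ j → Walk (SumIn sums′) first (tour j) (tour-end j)
      walk-tour zero    = walk-map (λ s → there (there s)) walk
      walk-tour (suc j) = walk-++ (walk-tour j) (here (junction j))
                                  (walk-map (λ s → there (there s)) (walk-block (suc j · e)))

      length-tour : ∀ j → length (tour j) ≡ length rest + j * (length L + length L)
      length-tour zero    = sym (ℕₚ.+-identityʳ (length rest))
      length-tour (suc j) = begin
        length (tour j ++ block (suc j · e))          ≡⟨ length-++ (tour j) ⟩
        length (tour j) + length (block (suc j · e))  ≡⟨ cong₂ _+_ (length-tour j) (length-block (suc j · e)) ⟩
        length rest + j * d + d                       ≡⟨ ℕₚ.+-assoc (length rest) (j * d) d ⟩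
        length rest + (j * d + d)                     ≡⟨ cong (length rest +_) (ℕₚ.+-comm (j * d) d) ⟩
        length rest + suc j * d                       ∎
        where
        d : ℕ
        d = length L + length L

      length-cycle : length (first ∷ tour M) ≡ suc (M + M) * n
      length-cycle = begin
        suc (length (tour M))                                   ≡⟨ cong suc (length-tour M) ⟩
        suc (length rest + M * (length L + length L))           ≡⟨ count (length rest) M ⟩
        suc (M + M) * length L                                  ≡⟨ cong (suc (M + M) *_) length≡ ⟩
        suc (M + M) * n                                         ∎
        where
        count : ∀ r M → suc (r + M * (suc r + suc r)) ≡ suc (M + M) * suc r
        count = solve-∀

      tour-mono : ∀ {j j′ z} → j ≤′ j′ → z ∈ tour j → z ∈ tour j′
      tour-mono ≤′-refl        z∈ = z∈
      tour-mono (≤′-step j≤j′) z∈ = ∈-++⁺ˡ (tour-mono j≤j′ z∈)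

      L⊆cycle : ∀ {z} → z ∈ L → z ∈ first ∷ tour M
      L⊆cycle (here refl)    = here refl
      L⊆cycle (there z∈rest) = there (tour-mono {j′ = M} (ℕₚ.≤⇒≤′ z≤n) z∈rest)

      block⊆cycle : ∀ {k z} → suc k ≤ M → z ∈ block (suc k · e) → z ∈ first ∷ tour M
      block⊆cycle {k} k<M z∈ = there (tour-mono {j′ = M} (ℕₚ.≤⇒≤′ k<M) (∈-++⁺ʳ (tour k) z∈))

      visits-cycle : ∀ {g} → g ∈⟨ e ∷ hs ⟩ → g ∈ first ∷ tour M
      visits-cycle g∈ with coset-decomposition {m = suc (M + M)} m·e∈⟨⟩ g∈
      ... | zero  , _   , h , h∈ , refl = subst (_∈ first ∷ tour M) (sym (identityˡ h)) (L⊆cycle (visits h∈))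
      ... | suc k , k<m , h , h∈ , refl with suc k ≤? M
      ...   | yes k<M = block⊆cycle k<M (proj₁ (∈-block (visits h∈)))
      ...   | no  k≮M = block⊆cycle o<M (subst (_∈ block (suc o · e)) complement
                                               (proj₂ (∈-block (visits (⊕-∈⟨⟩ hs m·e∈⟨⟩ h∈)))))
        where
        -- beyond M, the coset of (1 + k)·e is that of −(m − 1 − k)·e, visited by a negative shift
        o : ℕ
        o = proj₁ (ℕₚ.m≤n⇒∃[o]m+o≡n k<m)
        k+o≡m : suc k + suc o ≡ suc (M + M)
        k+o≡m = trans (ℕₚ.+-suc (suc k) o) (proj₂ (ℕₚ.m≤n⇒∃[o]m+o≡n k<m))
        o<M : suc o ≤ M
        o<M = ℕₚ.+-cancelˡ-≤ M (suc o) M (ℕₚ.≤-pred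
          (ℕₚ.≤-trans (ℕₚ.+-monoˡ-≤ (suc o) (ℕₚ.≰⇒> k≮M)) (ℕₚ.≤-reflexive k+o≡m)))
        complement : ⊖ (suc o · e) ⊕ (suc (M + M) · e ⊕ h) ≡ suc k · e ⊕ h
        complement = trans (cong (λ t → ⊖ (suc o · e) ⊕ (t · e ⊕ h)) (sym k+o≡m))
                           (⊖l·g⊕[[k+l]·g⊕h]≡k·g⊕h (suc k) (suc o) e h)

    extend : CayleyCycle (e ∷ hs) (suc (M + M) * n)
    extend = record
      { sums        = sums′
      ; sums-length = ℕₚ.≤-trans (s≤s (s≤s sums-length))
                                 (ℕₚ.≤-reflexive (cong (_+ 1) (sym (ℕₚ.*-suc 2 (length hs)))))
      ; first       = first
      ; rest        = tour M
      ; last        = tour-end M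
      ; walk        = walk-tour M
      ; closing     = SumIn-closing M
      ; length≡     = length-cycle
      ; visits      = visits-cycle
      }

  cayleyCycle : ∀ hs → ¬ 2 ∣ Enumeration.size (enumerate hs) → CayleyCycle hs (Enumeration.size (enumerate hs))
  cayleyCycle []       _     = record
    { sums        = 0# ∷ []
    ; sums-length = ℕₚ.≤-refl
    ; first       = 0#
    ; rest        = []
    ; last        = 0#
    ; walk        = []
    ; closing     = here (identityˡ 0#)
    ; length≡     = refl
    ; visits      = λ { refl → here refl }
    }
  cayleyCycle (e ∷ hs) 2∤mn =
    subst (CayleyCycle (e ∷ hs)) (cong (_* n) (sym ord≡1+2M)) (Extend.extend e M 1+2M·e∈⟨⟩ (cayleyCycle hs 2∤n) 2∤n)
    where
    open Adjoin e (enumerate hs) using (ord; ord·e∈⟨⟩)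
    n : ℕ
    n = Enumeration.size (enumerate hs)
    2∤n : ¬ 2 ∣ n
    2∤n = ¬∣m*n⇒¬∣n ord n 2∤mn
    M : ℕ
    M = proj₁ (¬2∣⇒≡1+[n+n] (¬∣m*n⇒¬∣m ord n 2∤mn))
    ord≡1+2M : ord ≡ suc (M + M)
    ord≡1+2M = proj₂ (¬2∣⇒≡1+[n+n] (¬∣m*n⇒¬∣m ord n 2∤mn))
    1+2M·e∈⟨⟩ : suc (M + M) · e ∈⟨ hs ⟩
    1+2M·e∈⟨⟩ = subst (λ k → k · e ∈⟨ hs ⟩) ord≡1+2M ord·e∈⟨⟩

  hamiltonian : ∀ {gs} → ¬ 2 ∣ order → Generates G gs →
                Σ (Subset order) λ S → ∣ S ∣ ≤ 2 * length gs + 1 × Hamiltonian G S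
  hamiltonian {gs} 2∤order generates =
    fromList sums , ℕₚ.≤-trans (∣fromList∣≤length sums) sums-length ,
    Product.map₂ (λ edges i → ∈⇒∈fromList (edges i))
      (closedWalk⇒permutation walk closing (trans length≡ size≡order) (λ g → visits (generates g)))
    where
    open Enumeration (enumerate gs)
    position : Elt → Fin size
    position g = proj₁ (⟨⟩⊆elem (generates g))
    position-injective : Injective _≡_ _≡_ position
    position-injective {g} {g′} eq = trans (sym (proj₂ (⟨⟩⊆elem (generates g))))
                                           (trans (cong elem eq) (proj₂ (⟨⟩⊆elem (generates g′))))
    size≡order : size ≡ order
    size≡order = Finₚ.cantor-schröder-bernstein elem-injective position-injective
    open CayleyCycle (cayleyCycle gs (2∤order ∘ subst (2 ∣_) size≡order))

lemma2 : (G : FiniteAbelianGroup) → 1 < FiniteAbelianGroup.order G →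
    ¬ (2 ∣ FiniteAbelianGroup.order G) → (r : ℕ) → IsRank G r →
    Σ (Subset (FiniteAbelianGroup.order G)) λ S →
    (∣ S ∣ ≤ 2 * r + 1) × Hamiltonian G S
lemma2 G _ 2∤order _ ((_ , generates , refl) , _) = hamiltonian G 2∤order generates
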